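{- Let $S$ be a totally ordered set with $|S|=n\ge2$, let $C$ be a division of $S$, and let $s\in S$ be admissible with respect to $C$. If $C$ is superdiagonal, then $C^s$ is superdiagonal; if $C$ is subdiagonal, then $C^s$ is subdiagonal.
   Context: A division of a totally ordered set $S$ with $|S|=n$ is a sequence $C=(C_1,\dots,C_n)$ of pairwise disjoint (possibly empty) sets with union $S$ and $s<t$ whenever $s\in C_i,t\in C_j,i<j$. An element $s$ is admissible w.r.t. $C$ if it is the smallest element of $C_1$, the largest element of $C_n$, or lies in $C_i$ with $i\ne1,n$. For admissible $s\in C_i$, with $C_i^-=\{t\in C_i:t<s\}$, $C_i^+=\{t\in C_i:t>s\}$, the deletion $C^s$ is: if $i=1$, $(C_1^+\cup C_2,C_3,\dots,C_n)$; if $i\ne1,n$, $(C_1,\dots,C_{i-2},C_{i-1}\cup C_i^-,C_i^+\cup C_{i+1},C_{i+2},\dots,C_n)$; if $i=n$, $(C_1,\dots,C_{n-2},C_{n-1}\cup C_n^-)$; it is a division of $S\setminus\{s\}$ into $n-1$ sets. A division $(C_1,\dots,C_N)$ is superdiagonal if $|C_1|+\dots+|C_i|\ge i$ for all $i$, and subdiagonal if $|C_N|+|C_{N-1}|+\dots+|C_{N-i+1}|\ge i$ for all $i$. -}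

module Defs where

open import Data.Nat as ℕ using (ℕ; zero; suc; _+_; _∸_; _<ᵇ_; _≡ᵇ_)
open import Data.Bool using (Bool; true; false; if_then_else_; _∧_)
open import Data.Fin as Fin using (Fin; toℕ; _<?_)
open import Data.Fin.Subset using (Subset; _∈_; _∪_; ∣_∣; ⊥)
open import Data.Vec using (tabulate; lookup)
open import Data.Product using (Σ; ∃; _×_)
open import Data.Sum using (_⊎_)
open import Relation.Nullary.Decidable using (⌊_⌋)
open import Relation.Binary.PropositionalEquality using (_≡_)

-- The totally ordered set S is modelled as a subset of Fin m (with the
-- order of Fin m); every finite totally ordered set arises this way.
-- A sequence of N sets C_1..C_N is a function Fin N → Subset m
-- (0-based indices: C_1 is C 0, C_N is C (N-1)).

record IsDivision {m N : ℕ} (S : Subset m) (C : Fin N → Subset m) : Set where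
  field
    disjoint : ∀ i j (x : Fin m) → x ∈ C i → x ∈ C j → i ≡ j
    inS      : ∀ i (x : Fin m) → x ∈ C i → x ∈ S
    covers   : ∀ (x : Fin m) → x ∈ S → ∃ λ i → x ∈ C i
    ordered  : ∀ i j (s t : Fin m) → s ∈ C i → t ∈ C j → i Fin.< j → s Fin.< t

Admissible : {m N : ℕ} → (C : Fin N → Subset m) → Fin N → Fin m → Set
Admissible {m} {N} C i s =
  s ∈ C i ×
  ( (toℕ i ≡ 0 × (∀ t → t ∈ C i → s Fin.≤ t))
  ⊎ (suc (toℕ i) ≡ N × (∀ t → t ∈ C i → t Fin.≤ s))
  ⊎ (0 ℕ.< toℕ i × suc (toℕ i) ℕ.< N))

-- Block with ℕ index (empty outside range).
blk : {m N : ℕ} → (Fin N → Subset m) → ℕ → Subset m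
blk {N = zero} C k = ⊥
blk {N = suc N} C zero = C Fin.zero
blk {N = suc N} C (suc k) = blk (λ j → C (Fin.suc j)) k

below above : {m : ℕ} → Subset m → Fin m → Subset m
below A s = tabulate λ t → lookup A t ∧ ⌊ t <? s ⌋
above A s = tabulate λ t → lookup A t ∧ ⌊ s <? t ⌋

-- Uniform formula:
--   D_j = C_j                     for j+1 < i
--   D_{i-1} = C_{i-1} ∪ C_i^-     (when i ≥ 1)
--   D_i = C_i^+ ∪ C_{i+1}         (when i ≤ N-2)
--   D_j = C_{j+1}                 for j > i
-- which specialises to the three cases of the paper.
deletion : {m N : ℕ} → (Fin N → Subset m) → Fin N → Fin m → Fin (N ∸ 1) → Subset m
deletion C i s j =
  if suc jn <ᵇ ii then blk C jn
  else if suc jn ≡ᵇ ii then blk C jn ∪ below (C i) s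
  else if jn ≡ᵇ ii then above (C i) s ∪ blk C (suc jn)
  else blk C (suc jn)
  where
  jn = toℕ j
  ii = toℕ i

prefixSize : {m N : ℕ} → (Fin N → Subset m) → ℕ → ℕ
prefixSize C zero = 0
prefixSize C (suc k) = prefixSize C k + ∣ blk C k ∣

suffixSize : {m N : ℕ} → (Fin N → Subset m) → ℕ → ℕ
suffixSize C zero = 0
suffixSize {N = N} C (suc k) = suffixSize C k + ∣ blk C (N ∸ suc k) ∣

Superdiagonal : {m N : ℕ} → (Fin N → Subset m) → Set
Superdiagonal {N = N} C = ∀ k → k ℕ.≤ N → k ℕ.≤ prefixSize C k

Subdiagonal : {m N : ℕ} → (Fin N → Subset m) → Set
Subdiagonal {N = N} C = ∀ k → k ℕ.≤ N → k ℕ.≤ suffixSize C k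

-- Deleting s ∈ C_i merges C_i^- into the preceding block and C_i^+ into the
-- following one, and shifts the later blocks down by one place.  Hence the prefix
-- sums of C^s agree with those of C before index i, exceed them by |C_i^-| at
-- index i, and afterwards lag exactly one element behind the prefix sums of C
-- taken one block further; so a bound k+1 ≤ |C_1|+…+|C_{k+1}| yields
-- k ≤ |C^s_1|+…+|C^s_k|.  Suffix sums are the total minus prefix sums, and the
-- total drops by exactly one, so subdiagonality transfers in the same way.
-- Admissibility covers the boundary blocks: C_1^- is empty when s is deleted
-- from the first block, and C_n^+ when it is deleted from the last.
module Submission where

open import Defs
open import Data.Nat using (ℕ; _≤_; _∸_)
open import Data.Fin using (Fin)
open import Data.Fin.Subset using (Subset; ∣_∣)
open import Data.Product using (_×_)
open import Relation.Binary.PropositionalEquality using (_≡_)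

open import Algebra.Properties.CommutativeSemigroup as CommSemigroup using ()
open import Data.Bool using (true; _∧_; if_then_else_)
open import Function using (_∘_)
open import Data.Empty using (⊥-elim)
open import Data.Fin as Fin using (toℕ; fromℕ<; _<?_)
open import Data.Fin.Properties as Finₚ using (toℕ-fromℕ<; toℕ<n)
open import Data.Fin.Subset using (_∈_; _∉_; _∪_; ⁅_⁆; inside; outside; _⊆_; Empty)
open import Data.Fin.Subset.Properties
  using (x∈p∪q⁻; x∈p∪q⁺; ⊆-antisym; x∈⁅x⁆; x∈⁅y⁆⇒x≡y; ∣⁅x⁆∣≡1; ∣⊥∣≡0; Empty-unique)
open import Data.Nat as ℕ using (zero; suc; _+_; _<_; _<ᵇ_; _≡ᵇ_; s≤s)
open import Data.Nat.Properties
  using (+-commutativeSemigroup; +-suc; +-assoc; +-comm; +-identityʳ; +-cancelʳ-≡;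
         <-irrefl; <-asym; <-trans; <-≤-trans; <⇒≤; <⇒≱; ≤-pred; ≤-refl; n≮n; n<1+n; 1+n≢n;
         m≤n⇒m<n∨m≡n; m≤n⇒m≤1+n; 0≢1+n; suc-injective; m≤m+n; m∸n≤m; +-∸-assoc; <-cmp; module ≤-Reasoning)
open import Data.Nat.Tactic.RingSolver using (solve-∀)
open import Data.Product using (_,_; proj₁; proj₂)
open import Data.Sum using (inj₁; inj₂)
open import Data.Vec using ([]; _∷_; tabulate; lookup; here; there)
open import Data.Vec.Properties using (lookup∘tabulate; []=⇒lookup; lookup⇒[]=)
open import Relation.Binary.Definitions using (tri<; tri≈; tri>)
open import Relation.Binary.PropositionalEquality
  using (refl; sym; trans; cong; cong₂; subst; module ≡-Reasoning)
open import Relation.Nullary using (yes)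
open import Relation.Nullary.Decidable using (⌊_⌋; isYes≗does; dec-true; dec-false)
open import Relation.Unary using (Pred; Decidable)

open CommSemigroup +-commutativeSemigroup using (xy∙z≈xz∙y; xy∙z≈x∙zy; x∙yz≈xz∙y)

∣p∪q∣≡∣p∣+∣q∣ : ∀ {m} (p q : Subset m) → (∀ {x} → x ∈ p → x ∉ q) →
                ∣ p ∪ q ∣ ≡ ∣ p ∣ + ∣ q ∣
∣p∪q∣≡∣p∣+∣q∣ []            []            _    = refl
∣p∪q∣≡∣p∣+∣q∣ (inside  ∷ p) (inside  ∷ q) disj = ⊥-elim (disj here here)
∣p∪q∣≡∣p∣+∣q∣ (inside  ∷ p) (outside ∷ q) disj =
  cong suc (∣p∪q∣≡∣p∣+∣q∣ p q λ x∈p x∈q → disj (there x∈p) (there x∈q))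
∣p∪q∣≡∣p∣+∣q∣ (outside ∷ p) (inside  ∷ q) disj =
  trans (cong suc (∣p∪q∣≡∣p∣+∣q∣ p q λ x∈p x∈q → disj (there x∈p) (there x∈q)))
        (sym (+-suc ∣ p ∣ ∣ q ∣))
∣p∪q∣≡∣p∣+∣q∣ (outside ∷ p) (outside ∷ q) disj =
  ∣p∪q∣≡∣p∣+∣q∣ p q λ x∈p x∈q → disj (there x∈p) (there x∈q)

module _ {m ℓ} {P : Pred (Fin m) ℓ} (P? : Decidable P) where

  restrict : Subset m → Subset m
  restrict p = tabulate λ t → lookup p t ∧ ⌊ P? t ⌋

  x∈restrict⁻ : ∀ {p x} → x ∈ restrict p → x ∈ p × P x
  x∈restrict⁻ {p} {x} x∈
    with lookup p x in eq | P? x | trans (sym (lookup∘tabulate _ x)) ([]=⇒lookup x∈)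
  ... | true | yes px | _ = lookup⇒[]= x p eq , px

  x∈restrict⁺ : ∀ {p x} → x ∈ p → P x → x ∈ restrict p
  x∈restrict⁺ {p} {x} x∈p px = lookup⇒[]= x (restrict p) (begin
    lookup (restrict p) x      ≡⟨ lookup∘tabulate _ x ⟩
    lookup p x ∧ ⌊ P? x ⌋      ≡⟨ cong₂ _∧_ ([]=⇒lookup x∈p) (trans (isYes≗does (P? x)) (dec-true (P? x) px)) ⟩
    true                       ∎)
    where open ≡-Reasoning

module _ {m} (p : Subset m) {s : Fin m} where

  x∈below⁻ : ∀ {x} → x ∈ below p s → x ∈ p × x Fin.< s
  x∈below⁻ = x∈restrict⁻ (_<? s)

  x∈above⁻ : ∀ {x} → x ∈ above p s → x ∈ p × s Fin.< x
  x∈above⁻ = x∈restrict⁻ (s <?_)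

  ∣p∣≡∣below∣+1+∣above∣ : s ∈ p → ∣ p ∣ ≡ ∣ below p s ∣ + 1 + ∣ above p s ∣
  ∣p∣≡∣below∣+1+∣above∣ s∈p = begin
    ∣ p ∣                                          ≡⟨ cong ∣_∣ (⊆-antisym split join) ⟩
    ∣ (below p s ∪ ⁅ s ⁆) ∪ above p s ∣            ≡⟨ ∣p∪q∣≡∣p∣+∣q∣ _ _ below∪s∉above ⟩
    ∣ below p s ∪ ⁅ s ⁆ ∣ + ∣ above p s ∣          ≡⟨ cong (_+ ∣ above p s ∣) (∣p∪q∣≡∣p∣+∣q∣ _ _ below∉s) ⟩
    ∣ below p s ∣ + ∣ ⁅ s ⁆ ∣ + ∣ above p s ∣      ≡⟨ cong (λ k → ∣ below p s ∣ + k + ∣ above p s ∣) (∣⁅x⁆∣≡1 s) ⟩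
    ∣ below p s ∣ + 1 + ∣ above p s ∣              ∎
    where
    open ≡-Reasoning

    below∉s : ∀ {x} → x ∈ below p s → x ∉ ⁅ s ⁆
    below∉s x∈ x∈s with x∈⁅y⁆⇒x≡y s x∈s
    ... | refl = <-irrefl refl (proj₂ (x∈below⁻ x∈))

    below∪s∉above : ∀ {x} → x ∈ below p s ∪ ⁅ s ⁆ → x ∉ above p s
    below∪s∉above x∈ x∈above with x∈p∪q⁻ (below p s) ⁅ s ⁆ x∈
    ... | inj₁ x∈below = <-asym (proj₂ (x∈below⁻ x∈below)) (proj₂ (x∈above⁻ x∈above))
    ... | inj₂ x∈s with x∈⁅y⁆⇒x≡y s x∈s
    ...   | refl = <-irrefl refl (proj₂ (x∈above⁻ x∈above))

    split : p ⊆ (below p s ∪ ⁅ s ⁆) ∪ above p s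
    split {x} x∈p with Finₚ.<-cmp x s
    ... | tri< x<s _ _ = x∈p∪q⁺ (inj₁ (x∈p∪q⁺ (inj₁ (x∈restrict⁺ (_<? s) x∈p x<s))))
    ... | tri≈ _ refl _ = x∈p∪q⁺ (inj₁ (x∈p∪q⁺ (inj₂ (x∈⁅x⁆ s))))
    ... | tri> _ _ s<x = x∈p∪q⁺ (inj₂ (x∈restrict⁺ (s <?_) x∈p s<x))

    join : (below p s ∪ ⁅ s ⁆) ∪ above p s ⊆ p
    join x∈ with x∈p∪q⁻ (below p s ∪ ⁅ s ⁆) (above p s) x∈
    ... | inj₂ x∈above = proj₁ (x∈above⁻ x∈above)
    ... | inj₁ x∈ with x∈p∪q⁻ (below p s) ⁅ s ⁆ x∈
    ...   | inj₁ x∈below = proj₁ (x∈below⁻ x∈below)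
    ...   | inj₂ x∈s with x∈⁅y⁆⇒x≡y s x∈s
    ...     | refl = s∈p

  ∣below∣≡0 : (∀ t → t ∈ p → s Fin.≤ t) → ∣ below p s ∣ ≡ 0
  ∣below∣≡0 s-min = trans (cong ∣_∣ (Empty-unique none)) (∣⊥∣≡0 m)
    where
    none : Empty (below p s)
    none (x , x∈) = <⇒≱ (proj₂ (x∈below⁻ x∈)) (s-min x (proj₁ (x∈below⁻ x∈)))

  ∣above∣≡0 : (∀ t → t ∈ p → t Fin.≤ s) → ∣ above p s ∣ ≡ 0
  ∣above∣≡0 s-max = trans (cong ∣_∣ (Empty-unique none)) (∣⊥∣≡0 m)
    where
    none : Empty (above p s)
    none (x , x∈) = <⇒≱ (proj₂ (x∈above⁻ x∈)) (s-max x (proj₁ (x∈above⁻ x∈)))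

blk-toℕ : ∀ {m N} (F : Fin N → Subset m) (i : Fin N) → blk F (toℕ i) ≡ F i
blk-toℕ F Fin.zero    = refl
blk-toℕ F (Fin.suc i) = blk-toℕ (λ j → F (Fin.suc j)) i

blk-fromℕ< : ∀ {m N} (F : Fin N → Subset m) {j} (j<N : j < N) → blk F j ≡ F (fromℕ< j<N)
blk-fromℕ< F j<N = trans (cong (blk F) (sym (toℕ-fromℕ< j<N))) (blk-toℕ F (fromℕ< j<N))

module _ {m N} (C : Fin (suc N) → Subset m) (i : Fin (suc N)) (s : Fin m) where

  private
    ι : ℕ
    ι = toℕ i

    deletionℕ : ℕ → Subset m
    deletionℕ j =
      if suc j <ᵇ ι then blk C j
      else if suc j ≡ᵇ ι then blk C j ∪ below (C i) s
      else if j ≡ᵇ ι then above (C i) s ∪ blk C (suc j)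
      else blk C (suc j)

    blk-deletion : ∀ {j} → j < N → blk (deletion C i s) j ≡ deletionℕ j
    blk-deletion j<N =
      trans (blk-fromℕ< (deletion C i s) j<N) (cong deletionℕ (toℕ-fromℕ< j<N))

  blk-deletion-< : ∀ {j} → j < N → suc j < ι → blk (deletion C i s) j ≡ blk C j
  blk-deletion-< {j} j<N j+1<ι
    rewrite blk-deletion j<N | dec-true (suc j ℕ.<? ι) j+1<ι = refl

  blk-deletion-pred : ∀ {j} → j < N → suc j ≡ ι →
                      blk (deletion C i s) j ≡ blk C j ∪ below (C i) s
  blk-deletion-pred {j} j<N j+1≡ι
    rewrite blk-deletion j<N
          | dec-false (suc j ℕ.<? ι) (<-irrefl j+1≡ι)
          | dec-true (suc j ℕ.≟ ι) j+1≡ι = refl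

  blk-deletion-≡ : ∀ {j} → j < N → j ≡ ι →
                   blk (deletion C i s) j ≡ above (C i) s ∪ blk C (suc j)
  blk-deletion-≡ {j} j<N refl
    rewrite blk-deletion j<N
          | dec-false (suc j ℕ.<? j) (n≮n j ∘ <-trans (n<1+n j))
          | dec-false (suc j ℕ.≟ j) (1+n≢n)
          | dec-true (j ℕ.≟ j) refl = refl

  blk-deletion-> : ∀ {j} → j < N → ι < j → blk (deletion C i s) j ≡ blk C (suc j)
  blk-deletion-> {j} j<N ι<j
    rewrite blk-deletion j<N
          | dec-false (suc j ℕ.<? ι) (<-asym ι<j ∘ <-trans (n<1+n j))
          | dec-false (suc j ℕ.≟ ι) (λ j+1≡ι → <-asym ι<j (subst (j <_) j+1≡ι (n<1+n j)))
          | dec-false (j ℕ.≟ ι) (λ j≡ι → <-irrefl (sym j≡ι) ι<j) = refl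

suffixSize+prefixSize : ∀ {m N} (F : Fin N → Subset m) {k} → k ≤ N →
                        suffixSize F k + prefixSize F (N ∸ k) ≡ prefixSize F N
suffixSize+prefixSize F {zero}          _   = refl
suffixSize+prefixSize {N = N} F {suc k} k<N = begin
  suffixSize F k + ∣ blk F (N ∸ suc k) ∣ + prefixSize F (N ∸ suc k) ≡⟨ xy∙z≈x∙zy (suffixSize F k) _ (prefixSize F (N ∸ suc k)) ⟩
  suffixSize F k + prefixSize F (suc (N ∸ suc k))                   ≡⟨ cong (λ j → suffixSize F k + prefixSize F j) (sym (+-∸-assoc 1 k<N)) ⟩
  suffixSize F k + prefixSize F (N ∸ k)                             ≡⟨ suffixSize+prefixSize F (<⇒≤ k<N) ⟩
  prefixSize F N                                                    ∎
  where open ≡-Reasoning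

module Deletion {m N} (C : Fin (suc N) → Subset m)
                (disjoint : ∀ j k (x : Fin m) → x ∈ C j → x ∈ C k → j ≡ k)
                (i : Fin (suc N)) (s : Fin m) (s∈Cᵢ : s ∈ C i) where

  private
    ι b a : ℕ
    ι = toℕ i
    b = ∣ below (C i) s ∣
    a = ∣ above (C i) s ∣

    D : Fin N → Subset m
    D = deletion C i s

    c d : ℕ → ℕ
    c j = ∣ blk C j ∣
    d j = ∣ blk D j ∣

    PC PD SC SD : ℕ → ℕ
    PC = prefixSize C
    PD = prefixSize D
    SC = suffixSize C
    SD = suffixSize D

    ι≤N : ι ≤ N
    ι≤N = ≤-pred (toℕ<n i)

  c-ι : c ι ≡ b + 1 + a
  c-ι = trans (cong ∣_∣ (blk-toℕ C i)) (∣p∣≡∣below∣+1+∣above∣ (C i) s∈Cᵢ)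

  blk-meets-Cᵢ : ∀ {j x} → j < suc N → x ∈ blk C j → x ∈ C i → j ≡ ι
  blk-meets-Cᵢ j<N+1 x∈Cⱼ x∈Cᵢ = trans (sym (toℕ-fromℕ< j<N+1))
    (cong toℕ (disjoint _ _ _ (subst (_ ∈_) (blk-fromℕ< C j<N+1) x∈Cⱼ) x∈Cᵢ))

  d-< : ∀ {j} → j < N → suc j < ι → d j ≡ c j
  d-< j<N j+1<ι = cong ∣_∣ (blk-deletion-< C i s j<N j+1<ι)

  d-pred : ∀ {j} → j < N → suc j ≡ ι → d j ≡ c j + b
  d-pred j<N j+1≡ι = trans (cong ∣_∣ (blk-deletion-pred C i s j<N j+1≡ι))
    (∣p∪q∣≡∣p∣+∣q∣ _ _ λ x∈Cⱼ x∈below →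
      1+n≢n (trans j+1≡ι (sym (blk-meets-Cᵢ (<-trans j<N (n<1+n N)) x∈Cⱼ
                                             (proj₁ (x∈below⁻ (C i) x∈below))))))

  d-≡ : ∀ {j} → j < N → j ≡ ι → d j ≡ a + c (suc j)
  d-≡ {j} j<N j≡ι = trans (cong ∣_∣ (blk-deletion-≡ C i s j<N j≡ι))
    (∣p∪q∣≡∣p∣+∣q∣ (above (C i) s) (blk C (suc j)) λ x∈above x∈Cⱼ₊₁ →
      1+n≢n (trans (blk-meets-Cᵢ (s≤s j<N) x∈Cⱼ₊₁ (proj₁ (x∈above⁻ (C i) x∈above)))
                   (sym j≡ι)))

  d-> : ∀ {j} → j < N → ι < j → d j ≡ c (suc j)
  d-> j<N ι<j = cong ∣_∣ (blk-deletion-> C i s j<N ι<j)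

  module Diagonals (first : ι ≡ 0 → b ≡ 0) (last : ι ≡ N → a ≡ 0) where

    prefix-< : ∀ {k} → k < ι → PD k ≡ PC k
    prefix-< {zero}  _      = refl
    prefix-< {suc k} k+1<ι = cong₂ _+_ (prefix-< k<ι) (d-< (<-≤-trans k<ι ι≤N) k+1<ι)
      where
      k<ι : k < ι
      k<ι = <-trans (n<1+n k) k+1<ι

    prefix-≡ : ∀ {k} → k ≡ ι → PD k ≡ PC k + b
    prefix-≡ {zero}  0≡ι    = sym (first (sym 0≡ι))
    prefix-≡ {suc k} k+1≡ι = begin
      PD k + d k       ≡⟨ cong₂ _+_ (prefix-< k<ι) (d-pred (<-≤-trans k<ι ι≤N) k+1≡ι) ⟩
      PC k + (c k + b) ≡⟨ sym (+-assoc (PC k) (c k) b) ⟩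
      PC k + c k + b   ∎
      where
      open ≡-Reasoning
      k<ι : k < ι
      k<ι = subst (k <_) k+1≡ι (n<1+n k)

    prefix-> : ∀ {k} → ι < k → k ≤ N → PD k + 1 ≡ PC (suc k)
    prefix-> {suc k} (s≤s ι≤k) k+1≤N with m≤n⇒m<n∨m≡n ι≤k
    ... | inj₁ ι<k = begin
      PD k + d k + 1         ≡⟨ xy∙z≈xz∙y (PD k) (d k) 1 ⟩
      PD k + 1 + d k         ≡⟨ cong₂ _+_ (prefix-> ι<k (<⇒≤ k+1≤N)) (d-> k+1≤N ι<k) ⟩
      PC (suc k) + c (suc k) ∎
      where open ≡-Reasoning
    ... | inj₂ refl = begin
      PD ι + d ι + 1                 ≡⟨ cong₂ (λ x y → x + y + 1) (prefix-≡ refl) (d-≡ k+1≤N refl) ⟩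
      PC ι + b + (a + c (suc ι)) + 1 ≡⟨ regroup (PC ι) b a (c (suc ι)) ⟩
      PC ι + (b + 1 + a) + c (suc ι) ≡⟨ cong (λ x → PC ι + x + c (suc ι)) (sym c-ι) ⟩
      PC ι + c ι + c (suc ι)         ∎
      where
      open ≡-Reasoning
      regroup : ∀ p b a c → p + b + (a + c) + 1 ≡ p + (b + 1 + a) + c
      regroup = solve-∀

    prefix-total : PD N + 1 ≡ PC (suc N)
    prefix-total with m≤n⇒m<n∨m≡n ι≤N
    ... | inj₁ ι<N = prefix-> ι<N ≤-refl
    ... | inj₂ ι≡N = begin
      PD N + 1         ≡⟨ cong (_+ 1) (prefix-≡ (sym ι≡N)) ⟩
      PC N + b + 1     ≡⟨ +-assoc (PC N) b 1 ⟩
      PC N + (b + 1)   ≡⟨ cong (PC N +_) (sym (+-identityʳ (b + 1))) ⟩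
      PC N + (b + 1 + 0) ≡⟨ cong (λ x → PC N + (b + 1 + x)) (sym (last ι≡N)) ⟩
      PC N + (b + 1 + a) ≡⟨ cong (PC N +_) (sym (trans (cong c (sym ι≡N)) c-ι)) ⟩
      PC N + c N       ∎
      where open ≡-Reasoning

    superdiagonal : Superdiagonal C → Superdiagonal D
    superdiagonal sup k k≤N with <-cmp k ι
    ... | tri< k<ι _ _ = begin
      k    ≤⟨ sup k (m≤n⇒m≤1+n k≤N) ⟩
      PC k ≡⟨ prefix-< k<ι ⟨
      PD k ∎
      where open ≤-Reasoning
    ... | tri≈ _ k≡ι _ = begin
      k        ≤⟨ sup k (m≤n⇒m≤1+n k≤N) ⟩
      PC k     ≤⟨ m≤m+n (PC k) b ⟩
      PC k + b ≡⟨ prefix-≡ k≡ι ⟨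
      PD k     ∎
      where open ≤-Reasoning
    ... | tri> _ _ ι<k = ≤-pred (begin
      suc k      ≤⟨ sup (suc k) (s≤s k≤N) ⟩
      PC (suc k) ≡⟨ prefix-> ι<k k≤N ⟨
      PD k + 1   ≡⟨ +-comm (PD k) 1 ⟩
      suc (PD k) ∎)
      where open ≤-Reasoning

    suffix-balance : ∀ {k} → k ≤ N → SD k + PD (N ∸ k) + 1 ≡ SC k + PC (suc (N ∸ k))
    suffix-balance {k} k≤N = begin
      SD k + PD (N ∸ k) + 1   ≡⟨ cong (_+ 1) (suffixSize+prefixSize D k≤N) ⟩
      PD N + 1                ≡⟨ prefix-total ⟩
      PC (suc N)              ≡⟨ suffixSize+prefixSize C (m≤n⇒m≤1+n k≤N) ⟨
      SC k + PC (suc N ∸ k)   ≡⟨ cong (λ j → SC k + PC j) (+-∸-assoc 1 k≤N) ⟩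
      SC k + PC (suc (N ∸ k)) ∎
      where open ≡-Reasoning

    suffix-< : ∀ {k} → N ∸ k < ι → k ≤ N → SD k + 1 ≡ SC (suc k)
    suffix-< {k} k′<ι k≤N = +-cancelʳ-≡ (PC k′) (SD k + 1) (SC (suc k)) (begin
      SD k + 1 + PC k′      ≡⟨ xy∙z≈xz∙y (SD k) 1 (PC k′) ⟩
      SD k + PC k′ + 1      ≡⟨ cong (λ x → SD k + x + 1) (prefix-< k′<ι) ⟨
      SD k + PD k′ + 1      ≡⟨ suffix-balance k≤N ⟩
      SC k + (PC k′ + c k′) ≡⟨ x∙yz≈xz∙y (SC k) (PC k′) (c k′) ⟩
      SC k + c k′ + PC k′   ∎)
      where
      open ≡-Reasoning
      k′ = N ∸ k

    suffix-≡ : ∀ {k} → N ∸ k ≡ ι → k ≤ N → SD k ≡ SC k + a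
    suffix-≡ {k} k′≡ι k≤N = +-cancelʳ-≡ (PC k′ + b + 1) (SD k) (SC k + a) (begin
      SD k + (PC k′ + b + 1)   ≡⟨ +-assoc (SD k) (PC k′ + b) 1 ⟨
      SD k + (PC k′ + b) + 1   ≡⟨ cong (λ x → SD k + x + 1) (prefix-≡ k′≡ι) ⟨
      SD k + PD k′ + 1         ≡⟨ suffix-balance k≤N ⟩
      SC k + (PC k′ + c k′)    ≡⟨ cong (λ x → SC k + (PC k′ + x)) (trans (cong c k′≡ι) c-ι) ⟩
      SC k + (PC k′ + (b + 1 + a)) ≡⟨ regroup (SC k) (PC k′) b a ⟩
      SC k + a + (PC k′ + b + 1) ∎)
      where
      open ≡-Reasoning
      k′ = N ∸ k
      regroup : ∀ z p b a → z + (p + (b + 1 + a)) ≡ z + a + (p + b + 1)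
      regroup = solve-∀

    suffix-> : ∀ {k} → ι < N ∸ k → k ≤ N → SD k ≡ SC k
    suffix-> {k} ι<k′ k≤N = +-cancelʳ-≡ (PC (suc k′)) (SD k) (SC k) (begin
      SD k + PC (suc k′) ≡⟨ cong (SD k +_) (prefix-> ι<k′ (m∸n≤m N k)) ⟨
      SD k + (PD k′ + 1) ≡⟨ +-assoc (SD k) (PD k′) 1 ⟨
      SD k + PD k′ + 1   ≡⟨ suffix-balance k≤N ⟩
      SC k + PC (suc k′) ∎)
      where
      open ≡-Reasoning
      k′ = N ∸ k

    subdiagonal : Subdiagonal C → Subdiagonal D
    subdiagonal sub k k≤N with <-cmp (N ∸ k) ι
    ... | tri< k′<ι _ _ = ≤-pred (begin
      suc k      ≤⟨ sub (suc k) (s≤s k≤N) ⟩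
      SC (suc k) ≡⟨ suffix-< k′<ι k≤N ⟨
      SD k + 1   ≡⟨ +-comm (SD k) 1 ⟩
      suc (SD k) ∎)
      where open ≤-Reasoning
    ... | tri≈ _ k′≡ι _ = begin
      k        ≤⟨ sub k (m≤n⇒m≤1+n k≤N) ⟩
      SC k     ≤⟨ m≤m+n (SC k) a ⟩
      SC k + a ≡⟨ suffix-≡ k′≡ι k≤N ⟨
      SD k     ∎
      where open ≤-Reasoning
    ... | tri> _ _ ι<k′ = begin
      k    ≤⟨ sub k (m≤n⇒m≤1+n k≤N) ⟩
      SC k ≡⟨ suffix-> ι<k′ k≤N ⟨
      SD k ∎
      where open ≤-Reasoning

module _ {m K} {C : Fin (2 + K) → Subset m} {i : Fin (2 + K)} {s : Fin m} where

  admissible-first⇒∣below∣≡0 : Admissible C i s → toℕ i ≡ 0 → ∣ below (C i) s ∣ ≡ 0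
  admissible-first⇒∣below∣≡0 (_ , inj₁ (_ , s-min))          _   = ∣below∣≡0 (C i) s-min
  admissible-first⇒∣below∣≡0 (_ , inj₂ (inj₁ (i+1≡2+K , _))) i≡0 =
    ⊥-elim (0≢1+n (trans (sym i≡0) (suc-injective i+1≡2+K)))
  admissible-first⇒∣below∣≡0 (_ , inj₂ (inj₂ (0<i , _)))     i≡0 = ⊥-elim (<-irrefl (sym i≡0) 0<i)

  admissible-last⇒∣above∣≡0 : Admissible C i s → toℕ i ≡ suc K → ∣ above (C i) s ∣ ≡ 0
  admissible-last⇒∣above∣≡0 (_ , inj₂ (inj₁ (_ , s-max)))    _     = ∣above∣≡0 (C i) s-max
  admissible-last⇒∣above∣≡0 (_ , inj₁ (i≡0 , _))              i≡1+K = ⊥-elim (0≢1+n (trans (sym i≡0) i≡1+K))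
  admissible-last⇒∣above∣≡0 (_ , inj₂ (inj₂ (_ , i+1<2+K)))  i≡1+K =
    ⊥-elim (<-irrefl (cong suc i≡1+K) i+1<2+K)

mainTheorem7 : ∀ (m n : ℕ) (S : Subset m) → ∣ S ∣ ≡ n → 2 ≤ n →
    (C : Fin n → Subset m) → IsDivision S C →
    (i : Fin n) (s : Fin m) → Admissible C i s →
    (Superdiagonal C → Superdiagonal (deletion C i s))
    × (Subdiagonal C → Subdiagonal (deletion C i s))
mainTheorem7 m (suc (suc K)) S _ (s≤s (s≤s _)) C division i s admissible =
  superdiagonal , subdiagonal
  where
  open Deletion C (IsDivision.disjoint division) i s (proj₁ admissible)
  open Diagonals (admissible-first⇒∣below∣≡0 {C = C} admissible)
                 (admissible-last⇒∣above∣≡0 {C = C} admissible)
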